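{- Let $G$ be a finite, simple, connected graph which is not an extended star graph, and let $\chi=\chi(G)$ be its (proper) vertex chromatic number. Then: (a) $\chi^o(G)$ is even if and only if $\chi=2$; (b) if $\chi^o(G)>1$ is odd, then $\chi=3$.
   Context: All graphs are finite, simple and connected. An extended star graph is a tree with exactly one vertex of degree $\geq3$. An oriented edge $[v,w]$ is an edge $\{v,w\}$ with input $v$ and output $w$; $\mathcal{O}=\{[v,w],[w,v]: v\sim w\}$. For $k\geq 1$, $G$ is circularly $k$-partite if $\mathcal{O}$ can be partitioned as $\mathcal{O}=\mathcal{O}_1\sqcup\cdots\sqcup\mathcal{O}_k$ with all $\mathcal{O}_j$ non-empty and such that $[v,w]\in\mathcal{O}_j$ implies $[w,z]\in\mathcal{O}_{j+1}$ for every $z\sim w$ with $z\neq v$, indices modulo $k$. The oriented edge periodic colouring number $\chi^o(G)$ is the largest $k$ such that $G$ is circularly $k$-partite. -}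

module Defs where

open import Data.Nat using (ℕ; zero; suc; _≤_; _%_; NonZero)
open import Data.Bool using (Bool; true; false; if_then_else_)
open import Data.Fin using (Fin; toℕ)
open import Data.List using (List; []; _∷_; _∷ʳ_; length; map; allFin)
open import Data.Nat.ListAction using (sum)
open import Data.List.Relation.Unary.Linked using (Linked)
open import Data.List.Relation.Unary.Unique.Propositional using (Unique)
open import Data.Product using (Σ; ∃; ∃-syntax; _×_; _,_)
open import Relation.Binary.PropositionalEquality using (_≡_; _≢_)
open import Relation.Nullary using (¬_)

record Graph (n : ℕ) : Set where
  field
    adj   : Fin n → Fin n → Bool
    sym   : ∀ v w → adj v w ≡ adj w v
    irrefl : ∀ v → adj v v ≡ false

open Graph public

module _ {n : ℕ} (G : Graph n) where

  E : Fin n → Fin n → Set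
  E v w = adj G v w ≡ true

  data Reach : Fin n → Fin n → Set where
    here : ∀ {v} → Reach v v
    step : ∀ {u v w} → E u v → Reach v w → Reach u w

  Connected : Set
  Connected = ∀ v w → Reach v w

  deg : Fin n → ℕ
  deg v = sum (map (λ w → if adj G v w then 1 else 0) (allFin n))

  HasCycle : Set
  HasCycle = Σ (Fin n) λ v → Σ (List (Fin n)) λ vs →
    (2 ≤ length vs) × Unique (v ∷ vs) × Linked E ((v ∷ vs) ∷ʳ v)

  IsTree : Set
  IsTree = Connected × ¬ HasCycle

  IsExtendedStar : Set
  IsExtendedStar = IsTree × (Σ (Fin n) λ v → (3 ≤ deg v) × (∀ w → 3 ≤ deg w → w ≡ v))

  Colourable : ℕ → Set
  Colourable c = Σ (Fin n → Fin c) λ f → ∀ v w → E v w → f v ≢ f w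

  IsChromaticNumber : ℕ → Set
  IsChromaticNumber c = Colourable c × (∀ k → Colourable k → c ≤ k)

  record CircularlyPartite (k : ℕ) : Set where
    field
      {{k-nonzero}} : NonZero k
      col      : (v w : Fin n) → E v w → Fin k
      nonempty : (j : Fin k) → Σ (Fin n) λ v → Σ (Fin n) λ w → Σ (E v w) λ e → col v w e ≡ j
      periodic : (v w z : Fin n) (e : E v w) (e' : E w z) → z ≢ v →
                 toℕ (col w z e') ≡ suc (toℕ (col v w e)) % k

  -- χ^o(G) = m : the largest k such that G is circularly k-partite
  IsOrientedEdgePeriodicColouringNumber : ℕ → Set
  IsOrientedEdgePeriodicColouringNumber m =
    CircularlyPartite m × (∀ k → CircularlyPartite k → k ≤ m)

-- Let c be a circular k-partition, read as labels in ℤ/k. Along a non-backtracking walk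
-- the label grows by one per step, and c[v,w] + c[w,v] is the same for every edge.
--
-- If k is even, an odd closed walk would reduce to an odd closed walk that does not
-- backtrack even where it closes; its length is a multiple of k, which is absurd, so G
-- is bipartite.
--
-- If k = 2M + 1, shift c so that c[v,w] + c[w,v] ≡ 1. Then the height |c[u,w]| ∈ [0, M]
-- depends only on w and changes by exactly one along every edge, except along a matching
-- of edges with c[v,w] = c[w,v] = M + 1; the parity of the height, corrected on that
-- matching, is a proper 3-colouring. If G is moreover bipartite, combining c with the
-- bipartition through ℤ/2k ≅ ℤ/k × ℤ/2 gives a labelling mod 2k whose height changes by
-- exactly one along every edge. Along a path between a vertex of height 0 and one of
-- height M + 1 all intermediate heights occur, and from them one reads off a circular
-- partition with 2k classes (if some height equals k) or k + 1 classes (otherwise); so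
-- χᵒ(G) is never odd when χ(G) = 2.

module Submission where

open import Defs hiding (sym)
open import Data.Nat using (ℕ; _<_)
open import Data.Nat.Divisibility using (_∣_)
open import Data.Product using (_×_)
open import Function.Bundles using (_⇔_)
open import Relation.Binary.PropositionalEquality using (_≡_)
open import Relation.Nullary using (¬_)

open import Axiom.UniquenessOfIdentityProofs using (module Decidable⇒UIP)
open import Data.Bool using (Bool; true; false)
import Data.Bool.Properties as Bool
open import Data.Empty using (⊥)
import Data.Fin as Fin
open import Data.Fin using (Fin; toℕ; fromℕ; fromℕ<; inject₁; inject≤)
open import Data.Fin.Properties
  using (toℕ<n; toℕ-fromℕ<; toℕ-injective; fromℕ≢inject₁; inject₁-injective; inject≤-injective; any?)
  renaming (_≟_ to _≟ᶠ_)
open import Data.Nat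
open import Data.Nat.DivMod
open import Data.Nat.Divisibility using (divides; _∣?_; ∣-trans; ∣-refl; ∣m∣n⇒∣m+n; _∣0; m%n≡0⇒n∣m)
open import Data.Nat.Properties
open import Algebra.Properties.CommutativeSemigroup +-commutativeSemigroup
  using () renaming (interchange to +-interchange)
open import Data.Parity.Base as ℙ using (Parity; 0ℙ; 1ℙ; _⁻¹)
import Data.Parity.Properties as ℙₚ
open import Data.Product using (Σ; ∃; ∃₂; _,_; proj₁; proj₂)
open import Data.Sum using (_⊎_; inj₁; inj₂; [_,_]′)
open import Data.Unit using (⊤; tt)
open import Function using (_∘_)
open import Function.Bundles using (mk⇔)
open import Relation.Binary.Definitions using (tri<; tri≈; tri>)
open import Relation.Binary.PropositionalEquality
  using (_≢_; refl; sym; trans; cong; cong₂; subst; module ≡-Reasoning)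
open import Relation.Nullary using (Dec; yes; no; contradiction)
open import Relation.Nullary.Decidable using (_×-dec_)

[m+n%d]%d≡[m+n]%d : ∀ m n d .{{_ : NonZero d}} → (m + n % d) % d ≡ (m + n) % d
[m+n%d]%d≡[m+n]%d m n d = begin
  (m + n % d) % d          ≡⟨ %-distribˡ-+ m (n % d) d ⟩
  (m % d + n % d % d) % d  ≡⟨ cong (λ x → (m % d + x) % d) (m%n%n≡m%n n d) ⟩
  (m % d + n % d) % d      ≡⟨ %-distribˡ-+ m n d ⟨
  (m + n) % d              ∎
  where open ≡-Reasoning

[m%d+n]%d≡[m+n]%d : ∀ m n d .{{_ : NonZero d}} → (m % d + n) % d ≡ (m + n) % d
[m%d+n]%d≡[m+n]%d m n d = begin
  (m % d + n) % d  ≡⟨ cong (_% d) (+-comm (m % d) n) ⟩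
  (n + m % d) % d  ≡⟨ [m+n%d]%d≡[m+n]%d n m d ⟩
  (n + m) % d      ≡⟨ cong (_% d) (+-comm n m) ⟩
  (m + n) % d      ∎
  where open ≡-Reasoning

[1+m]%d≡1+m%d : ∀ m d .{{_ : NonZero d}} → suc (m % d) < d → suc m % d ≡ suc (m % d)
[1+m]%d≡1+m%d m d lt = trans (sym ([m+n%d]%d≡[m+n]%d 1 m d)) (m<n⇒m%n≡m lt)

[d∸a%d+[a+z]]%d≡z%d : ∀ a z d .{{_ : NonZero d}} → (d ∸ a % d + (a + z)) % d ≡ z % d
[d∸a%d+[a+z]]%d≡z%d a z d = begin
  (c + (a + z)) % d      ≡⟨ cong (_% d) (+-assoc c a z) ⟨
  (c + a + z) % d        ≡⟨ [m%d+n]%d≡[m+n]%d (c + a) z d ⟨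
  ((c + a) % d + z) % d  ≡⟨ cong (λ r → (r + z) % d) c+a≡0 ⟩
  z % d                  ∎
  where
  open ≡-Reasoning
  c : ℕ
  c = d ∸ a % d
  c+a≡0 : (c + a) % d ≡ 0
  c+a≡0 = begin
    (c + a) % d      ≡⟨ [m+n%d]%d≡[m+n]%d c a d ⟨
    (c + a % d) % d  ≡⟨ cong (_% d) (m∸n+n≡m (m%n≤n a d)) ⟩
    d % d            ≡⟨ n%n≡0 d ⟩
    0                ∎

+-cancelˡ-% : ∀ a {x y} d .{{_ : NonZero d}} → (a + x) % d ≡ (a + y) % d → x % d ≡ y % d
+-cancelˡ-% a {x} {y} d eq = begin
  x % d                        ≡⟨ [d∸a%d+[a+z]]%d≡z%d a x d ⟨
  (c + (a + x)) % d            ≡⟨ [m+n%d]%d≡[m+n]%d c (a + x) d ⟨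
  (c + (a + x) % d) % d        ≡⟨ cong (λ z → (c + z) % d) eq ⟩
  (c + (a + y) % d) % d        ≡⟨ [m+n%d]%d≡[m+n]%d c (a + y) d ⟩
  (c + (a + y)) % d            ≡⟨ [d∸a%d+[a+z]]%d≡z%d a y d ⟩
  y % d                        ∎
  where
  open ≡-Reasoning
  c : ℕ
  c = d ∸ a % d

m<n+n⇒m≡m%n⊎m≡m%n+n : ∀ {m n} .{{_ : NonZero n}} → m < n + n → m ≡ m % n ⊎ m ≡ m % n + n
m<n+n⇒m≡m%n⊎m≡m%n+n {m} {n} m<2n with m <? n
... | yes m<n = inj₁ (sym (m<n⇒m%n≡m m<n))
... | no m≮n = inj₂ (begin
  m            ≡⟨ m∸n+n≡m n≤m ⟨
  m ∸ n + n    ≡⟨ cong (_+ n) (m<n⇒m%n≡m (m<n+o⇒m∸n<o m n m<2n)) ⟨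
  (m ∸ n) % n + n  ≡⟨ cong (_+ n) (m≤n⇒[n∸m]%m≡n%m n≤m) ⟩
  m % n + n    ∎)
  where
  open ≡-Reasoning
  n≤m : n ≤ m
  n≤m = ≮⇒≥ m≮n

0%n≡0 : ∀ n .{{_ : NonZero n}} → 0 % n ≡ 0
0%n≡0 n = m<n⇒m%n≡m (>-nonZero⁻¹ n)

m≡1+n⇒n≢1+m : ∀ {m n} → m ≡ suc n → n ≢ suc m
m≡1+n⇒n≢1+m {m} m≡1+n n≡1+m = <-irrefl (trans m≡1+n (cong suc n≡1+m)) (m<n⇒m<1+n (n<1+n m))

x+j≡N⇒x≡[N∸j]%N : ∀ {x j N} .{{_ : NonZero N}} → x < N → x ≡ 0 × j ≡ 0 ⊎ x + j ≡ N → x ≡ (N ∸ j) % N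
x+j≡N⇒x≡[N∸j]%N {N = N} _ (inj₁ (refl , refl)) = sym (n%n≡0 N)
x+j≡N⇒x≡[N∸j]%N {x} {j} {N} x<N (inj₂ x+j≡N) = begin
  x            ≡⟨ m<n⇒m%n≡m x<N ⟨
  x % N        ≡⟨ cong (_% N) (m+n∸n≡m x j) ⟨
  (x + j ∸ j) % N ≡⟨ cong (λ y → (y ∸ j) % N) x+j≡N ⟩
  (N ∸ j) % N  ∎
  where open ≡-Reasoning

m+m≡n+n⇒m≡n : ∀ {m n} → m + m ≡ n + n → m ≡ n
m+m≡n+n⇒m≡n {m} {n} eq with <-cmp m n
... | tri< m<n _ _ = contradiction eq (<⇒≢ (+-mono-< m<n m<n))
... | tri≈ _ m≡n _ = m≡n
... | tri> _ _ n<m = contradiction (sym eq) (<⇒≢ (+-mono-< n<m n<m))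

m+m≢1 : ∀ m → m + m ≢ 1
m+m≢1 (suc m) eq = contradiction (suc-injective (trans (sym (+-suc (suc m) m)) eq)) λ ()

parity-suc : ∀ m → parity (suc m) ≡ parity m ⁻¹
parity-suc m = sym (ℙₚ.⁻¹-selfInverse (ℙₚ.suc-homo-⁻¹ m))

parity-cong-suc : ∀ m n → parity m ≡ parity n → parity (suc m) ≡ parity (suc n)
parity-cong-suc m n eq = trans (parity-suc m) (trans (cong _⁻¹ eq) (sym (parity-suc n)))

parity-step : ∀ {a b} → a ≡ suc b → parity a ≢ parity b
parity-step {b = b} refl eq = ℙₚ.p≢p⁻¹ (parity b) (trans (sym eq) (parity-suc b))

parity-m+m : ∀ m → parity (m + m) ≡ 0ℙ
parity-m+m m = trans (ℙₚ.+-homo-+ m m) (ℙₚ.p+p≡0ℙ (parity m))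

parity-1+m+m : ∀ m → parity (suc (m + m)) ≡ 1ℙ
parity-1+m+m m = trans (parity-suc (m + m)) (cong _⁻¹ (parity-m+m m))

parity-even : ∀ {m} → 2 ∣ m → parity m ≡ 0ℙ
parity-even (divides q refl) = trans (ℙₚ.*-homo-* q 2) (ℙₚ.*-zeroʳ (parity q))

parity-%-even : ∀ m n .{{_ : NonZero n}} → parity n ≡ 0ℙ → parity (m % n) ≡ parity m
parity-%-even m n even = begin
  parity (m % n)                              ≡⟨ ℙₚ.+-identityʳ (parity (m % n)) ⟨
  parity (m % n) ℙ.+ 0ℙ                       ≡⟨ cong (parity (m % n) ℙ.+_) quotient-even ⟨
  parity (m % n) ℙ.+ parity (m / n * n)       ≡⟨ ℙₚ.+-homo-+ (m % n) (m / n * n) ⟨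
  parity (m % n + m / n * n)                  ≡⟨ cong parity (m≡m%n+[m/n]*n m n) ⟨
  parity m                                    ∎
  where
  open ≡-Reasoning
  quotient-even : parity (m / n * n) ≡ 0ℙ
  quotient-even = trans (ℙₚ.*-homo-* (m / n) n) (trans (cong (parity (m / n) ℙ.*_) even) (ℙₚ.*-zeroʳ _))

p≢q⇒p⁻¹≡q : ∀ {p q : Parity} → p ≢ q → p ⁻¹ ≡ q
p≢q⇒p⁻¹≡q {0ℙ} {0ℙ} ne = contradiction refl ne
p≢q⇒p⁻¹≡q {0ℙ} {1ℙ} _ = refl
p≢q⇒p⁻¹≡q {1ℙ} {0ℙ} _ = refl
p≢q⇒p⁻¹≡q {1ℙ} {1ℙ} ne = contradiction refl ne

⁻¹-+ : ∀ p q → p ⁻¹ ℙ.+ q ≡ (p ℙ.+ q) ⁻¹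
⁻¹-+ 0ℙ q = refl
⁻¹-+ 1ℙ 0ℙ = refl
⁻¹-+ 1ℙ 1ℙ = refl

parity-+-odd : ∀ a {k} → parity k ≡ 1ℙ → parity (a + k) ≡ parity a ⁻¹
parity-+-odd a {k} odd =
  trans (ℙₚ.+-homo-+ a k) (trans (cong (parity a ℙ.+_) odd) (ℙₚ.+-comm (parity a) 1ℙ))

private
  low≢high : ∀ {x y k} .{{_ : NonZero k}} → parity k ≡ 1ℙ →
    x ≡ x % k → y ≡ y % k + k → x % k ≡ y % k → parity x ≢ parity y
  low≢high {x} {y} {k} odd x≡ y≡ x≡y eq = ℙₚ.p≢p⁻¹ (parity (x % k)) (begin
    parity (x % k)           ≡⟨ cong parity x≡ ⟨
    parity x                 ≡⟨ eq ⟩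
    parity y                 ≡⟨ cong parity y≡ ⟩
    parity (y % k + k)       ≡⟨ parity-+-odd (y % k) odd ⟩
    parity (y % k) ⁻¹        ≡⟨ cong (λ r → parity r ⁻¹) x≡y ⟨
    parity (x % k) ⁻¹        ∎)
    where open ≡-Reasoning

residue-parity-injective : ∀ {x y k} .{{_ : NonZero k}} → parity k ≡ 1ℙ →
  x < k + k → y < k + k → x % k ≡ y % k → parity x ≡ parity y → x ≡ y
residue-parity-injective {x} {y} {k} odd x<2k y<2k x≡y parity-x≡y
  with m<n+n⇒m≡m%n⊎m≡m%n+n x<2k | m<n+n⇒m≡m%n⊎m≡m%n+n y<2k
... | inj₁ x≡ | inj₁ y≡ = trans x≡ (trans x≡y (sym y≡))
... | inj₂ x≡ | inj₂ y≡ = trans x≡ (trans (cong (_+ k) x≡y) (sym y≡))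
... | inj₁ x≡ | inj₂ y≡ = contradiction parity-x≡y (low≢high odd x≡ y≡ x≡y)
... | inj₂ x≡ | inj₁ y≡ = contradiction (sym parity-x≡y) (low≢high odd y≡ x≡ (sym x≡y))

module Walks {n : ℕ} (G : Graph n) where

  E-sym : ∀ {v w} → E G v w → E G w v
  E-sym {v} {w} e = trans (Graph.sym G w v) e

  E-irrefl : ∀ {v w} → E G v w → v ≢ w
  E-irrefl {v} e refl = contradiction (trans (sym e) (irrefl G v)) λ ()

  E? : ∀ v w → Dec (E G v w)
  E? v w = adj G v w Bool.≟ true

  length : ∀ {u w} → Reach G u w → ℕ
  length here = 0
  length (step _ r) = suc (length r)

  infixl 5 _∷ʳ_
  _∷ʳ_ : ∀ {u v w} → Reach G u v → E G v w → Reach G u w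
  here ∷ʳ e = step e here
  step e′ r ∷ʳ e = step e′ (r ∷ʳ e)

  infixr 5 _++_
  _++_ : ∀ {u v w} → Reach G u v → Reach G v w → Reach G u w
  here ++ r′ = r′
  step e r ++ r′ = step e (r ++ r′)

  reverse : ∀ {u w} → Reach G u w → Reach G w u
  reverse here = here
  reverse (step e r) = reverse r ∷ʳ E-sym e

  length-∷ʳ : ∀ {u v w} (r : Reach G u v) (e : E G v w) → length (r ∷ʳ e) ≡ suc (length r)
  length-∷ʳ here e = refl
  length-∷ʳ (step _ r) e = cong suc (length-∷ʳ r e)

  length-++ : ∀ {u v w} (r : Reach G u v) (r′ : Reach G v w) → length (r ++ r′) ≡ length r + length r′
  length-++ here r′ = refl
  length-++ (step _ r) r′ = cong suc (length-++ r r′)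

  length-reverse : ∀ {u w} (r : Reach G u w) → length (reverse r) ≡ length r
  length-reverse here = refl
  length-reverse (step e r) = trans (length-∷ʳ (reverse r) (E-sym e)) (cong suc (length-reverse r))

  unsnoc : ∀ {u v w} (e : E G u v) (r : Reach G v w) →
           ∃ λ y → Σ (Reach G u y) λ r′ → Σ (E G y w) λ e′ → r′ ∷ʳ e′ ≡ step e r
  unsnoc e here = _ , here , e , refl
  unsnoc e (step e′ r) with unsnoc e′ r
  ... | y , r′ , e″ , eq = y , step e r′ , e″ , cong (step e) eq

  NonBacktracking : ∀ {u w} → Reach G u w → Set
  NonBacktracking here = ⊤
  NonBacktracking (step _ here) = ⊤
  NonBacktracking (step {u = u} _ r@(step {v = x} _ _)) = u ≢ x × NonBacktracking r

  NonBacktracking-tail : ∀ {u v w} (e : E G u v) (r : Reach G v w) → NonBacktracking (step e r) → NonBacktracking r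
  NonBacktracking-tail e here _ = tt
  NonBacktracking-tail e (step _ _) (_ , nb) = nb

  NonBacktracking-init : ∀ {u v w} (r : Reach G u v) (e : E G v w) → NonBacktracking (r ∷ʳ e) → NonBacktracking r
  NonBacktracking-init here e _ = tt
  NonBacktracking-init (step _ here) e _ = tt
  NonBacktracking-init (step _ r@(step _ _)) e (ne , nb) = ne , NonBacktracking-init r e nb

  removeBacktracking : ∀ {u w} (r : Reach G u w) →
    Σ (Reach G u w) λ r′ → NonBacktracking r′ × parity (length r′) ≡ parity (length r)
  removeBacktracking here = here , tt , refl
  removeBacktracking (step e r) with removeBacktracking r
  ... | here , _ , p = step e here , tt , parity-cong-suc 0 (length r) p
  removeBacktracking {u} (step e r) | step {v = x} e′ r′ , nb , p with u ≟ᶠ x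
  ... | yes refl = r′ , NonBacktracking-tail e′ r′ nb , parity-cong-suc (suc (length r′)) (length r) p
  ... | no u≢x = step e (step e′ r′) , (u≢x , nb) , parity-cong-suc (suc (length r′)) (length r) p

  -- The closed walk c ∷ʳ e at x, with its last edge e repeated in front, so that
  -- NonBacktracking also forbids backtracking at the point where the walk closes.
  OddCyclicWalk : Set
  OddCyclicWalk = ∃₂ λ y x → Σ (E G y x) λ e → Σ (Reach G x y) λ c →
    NonBacktracking (step e (c ∷ʳ e)) × parity (length (c ∷ʳ e)) ≡ 1ℙ

  -- Peel off first and last edges while they backtrack; an odd closed walk cannot
  -- shrink to nothing.
  cyclicallyReduce : ∀ {u} (r : Reach G u u) → NonBacktracking r → parity (length r) ≡ 1ℙ → OddCyclicWalk
  cyclicallyReduce r = go (length r) r refl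
    where
    go : ∀ L {u} (r : Reach G u u) → length r ≡ L → NonBacktracking r → parity (length r) ≡ 1ℙ → OddCyclicWalk
    go _ here _ _ ()
    go _ (step e here) _ _ _ = contradiction refl (E-irrefl e)
    go (suc (suc L)) {u} (step {v = u₁} e₁ (step e₂ r₂)) len nb odd with unsnoc e₂ r₂
    ... | y , r₁ , e , eq with y ≟ᶠ u₁
    ... | no y≢u₁ = y , u , e , step e₁ r₁ ,
          (y≢u₁ , subst NonBacktracking (sym (cong (step e₁) eq)) nb) ,
          trans (cong (parity ∘ length) (cong (step e₁) eq)) odd
    ... | yes refl = go L r₁ shorter
          (NonBacktracking-init r₁ e (subst NonBacktracking (sym eq) (NonBacktracking-tail e₁ _ nb)))
          (trans (cong parity length-r₁) odd)
      where
      length-r₁ : length r₁ ≡ length r₂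
      length-r₁ = suc-injective (trans (sym (length-∷ʳ r₁ e)) (cong length eq))
      shorter : length r₁ ≡ L
      shorter = trans length-r₁ (suc-injective (suc-injective len))

module Colourings {n : ℕ} (G : Graph n) where
  open Walks G

  parityColour : Parity → Fin 2
  parityColour 0ℙ = Fin.zero
  parityColour 1ℙ = Fin.suc Fin.zero

  parityColour-injective : ∀ {p q} → parityColour p ≡ parityColour q → p ≡ q
  parityColour-injective {0ℙ} {0ℙ} _ = refl
  parityColour-injective {1ℙ} {1ℙ} _ = refl

  parity-colourable : (σ : Fin n → Parity) → (∀ {v w} → E G v w → σ v ≢ σ w) → Colourable G 2
  parity-colourable σ proper = parityColour ∘ σ , λ v w e → proper e ∘ parityColour-injective

  evenClosedWalks⇒2-colourable : Connected G → Fin n →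
    (∀ {u} (r : Reach G u u) → parity (length r) ≡ 0ℙ) → Colourable G 2
  evenClosedWalks⇒2-colourable conn r₀ even = parity-colourable σ proper
    where
    σ : Fin n → Parity
    σ w = parity (length (conn r₀ w))
    proper : ∀ {v w} → E G v w → σ v ≢ σ w
    proper {v} {w} e σv≡σw = contradiction (trans (sym (even closed)) odd) (ℙₚ.p≢p⁻¹ 0ℙ)
      where
      P = conn r₀ v
      Q = conn r₀ w
      closed : Reach G r₀ r₀
      closed = P ++ step e (reverse Q)
      odd : parity (length closed) ≡ 1ℙ
      odd = begin
        parity (length (P ++ step e (reverse Q)))          ≡⟨ cong parity (length-++ P (step e (reverse Q))) ⟩
        parity (length P + suc (length (reverse Q)))       ≡⟨ ℙₚ.+-homo-+ (length P) _ ⟩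
        σ v ℙ.+ parity (suc (length (reverse Q)))          ≡⟨ cong (λ m → σ v ℙ.+ parity (suc m)) (length-reverse Q) ⟩
        σ v ℙ.+ parity (suc (length Q))                    ≡⟨ cong (σ v ℙ.+_) (parity-suc (length Q)) ⟩
        σ v ℙ.+ σ w ⁻¹                                     ≡⟨ cong (λ p → σ v ℙ.+ p ⁻¹) σv≡σw ⟨
        σ v ℙ.+ σ v ⁻¹                                     ≡⟨ ℙₚ.p+p⁻¹≡1ℙ (σ v) ⟩
        1ℙ                                                 ∎
        where open ≡-Reasoning

  Colourable-mono : ∀ {c d} → c ≤ d → Colourable G c → Colourable G d
  Colourable-mono c≤d (f , proper) =
    (λ v → inject≤ (f v) c≤d) , λ v w e eq → proper v w e (inject≤-injective c≤d c≤d _ _ eq)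

  Colourable⇒2≤ : ∀ {c v w} → E G v w → Colourable G c → 2 ≤ c
  Colourable⇒2≤ {zero} {v} _ (f , _) with f v
  ... | ()
  Colourable⇒2≤ {suc zero} {v} {w} e (f , proper) with f v in eqv | f w in eqw
  ... | Fin.zero | Fin.zero = contradiction (trans eqv (sym eqw)) (proper v w e)
  Colourable⇒2≤ {suc (suc c)} _ _ = s≤s (s≤s z≤n)

module Labellings {n : ℕ} (G : Graph n) where
  open Walks G

  inNeighbour : Connected G → ∀ {v₀ w₀} → E G v₀ w₀ → ∀ w → ∃ λ u → E G u w
  inNeighbour conn {v₀} {w₀} e₀ w with w ≟ᶠ v₀
  ... | yes refl = w₀ , E-sym e₀
  ... | no w≢v₀ = firstStep (conn w v₀) w≢v₀
    where
    firstStep : ∀ {x} → Reach G w x → w ≢ x → ∃ λ u → E G u w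
    firstStep here w≢w = contradiction refl w≢w
    firstStep (step e _) _ = _ , E-sym e

  fromLabelling : ∀ {K} {{_ : NonZero K}} (f : Fin n → Fin n → ℕ) →
    (∀ {v w z} → E G v w → E G w z → z ≢ v → f w z % K ≡ suc (f v w) % K) →
    (∀ j → j < K → ∃₂ λ v w → E G v w × f v w % K ≡ j) →
    CircularlyPartite G K
  fromLabelling {K} f periodic onto = record
    { col = λ v w _ → fromℕ< (m%n<n (f v w) K)
    ; nonempty = λ j → let v , w , e , eq = onto (toℕ j) (toℕ<n j) in
        v , w , e , toℕ-injective (trans (toℕ-fromℕ< _) eq)
    ; periodic = λ v w z e e′ z≢v → begin
        toℕ (fromℕ< (m%n<n (f w z) K))          ≡⟨ toℕ-fromℕ< _ ⟩
        f w z % K                              ≡⟨ periodic e e′ z≢v ⟩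
        suc (f v w) % K                        ≡⟨ [m+n%d]%d≡[m+n]%d 1 (f v w) K ⟨
        suc (f v w % K) % K                    ≡⟨ cong (λ x → suc x % K) (toℕ-fromℕ< _) ⟨
        suc (toℕ (fromℕ< (m%n<n (f v w) K))) % K ∎
    }
    where open ≡-Reasoning

  intermediateEdge : (h : Fin n → ℕ) → (∀ {v w} → E G v w → h w ≡ suc (h v) ⊎ h v ≡ suc (h w)) →
    ∀ {p q j} → Reach G p q → h p ≤ j → j < h q → ∃₂ λ v w → E G v w × h v ≡ j × h w ≡ suc j
  intermediateEdge h steps here hp≤j j<hp = contradiction (≤-<-trans hp≤j j<hp) (<-irrefl refl)
  intermediateEdge h steps {p} {j = j} (step {v = u} e r) hp≤j j<hq with steps e
  ... | inj₂ down = intermediateEdge h steps r (≤-trans (n≤1+n (h u)) (subst (_≤ j) down hp≤j)) j<hq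
  ... | inj₁ up with h p ≟ j
  ... | yes hp≡j = p , u , e , hp≡j , trans up (cong suc hp≡j)
  ... | no hp≢j = intermediateEdge h steps r (subst (_≤ j) (sym up) (≤∧≢⇒< hp≤j hp≢j)) j<hq

  record Normalised (N : ℕ) {{_ : NonZero N}} (f : Fin n → Fin n → ℕ) : Set where
    field
      bounded      : ∀ v w → f v w < N
      periodic     : ∀ {v w z} → E G v w → E G w z → z ≢ v → f w z ≡ suc (f v w) % N
      reverseSum≡1 : ∀ {v w} → E G v w → (f v w + f w v) % N ≡ 1 % N

  -- Reading a normalised labelling as ±x ∈ ℤ/N, |f u w| depends only on the head w; this
  -- "height" changes by exactly one along every edge except those with f v w = f w v.
  module Height {N : ℕ} {{_ : NonZero N}} {f : Fin n → Fin n → ℕ} (F : Normalised N f)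
    (m : ℕ) (m+m≤N : m + m ≤ N) (N≤1+m+m : N ≤ suc (m + m)) (1≤m : 1 ≤ m)
    (inEdge : ∀ w → ∃ λ u → E G u w) where

    open Normalised F

    fold : ℕ → ℕ
    fold x with x ≤? m
    ... | yes _ = x
    ... | no _ = N ∸ x

    fold-small : ∀ {x} → x ≤ m → fold x ≡ x
    fold-small {x} x≤m with x ≤? m
    ... | yes _ = refl
    ... | no x≰m = contradiction x≤m x≰m

    fold-large : ∀ {x} → x < N → m < x → x + fold x ≡ N
    fold-large {x} x<N m<x with x ≤? m
    ... | yes x≤m = contradiction x≤m (<⇒≱ m<x)
    ... | no _ = m+[n∸m]≡n (<⇒≤ x<N)

    fold-cases : ∀ {x} → x < N → (x ≤ m × fold x ≡ x) ⊎ (m < x × x + fold x ≡ N)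
    fold-cases {x} x<N with x ≤? m
    ... | yes x≤m = inj₁ (x≤m , refl)
    ... | no x≰m = inj₂ (≰⇒> x≰m , m+[n∸m]≡n (<⇒≤ x<N))

    private
      N<large+large : ∀ {x y} → m < x → m < y → N < x + y
      N<large+large {x} {y} m<x m<y = begin-strict
        N                 ≤⟨ N≤1+m+m ⟩
        suc (m + m)       <⟨ s≤s (+-monoʳ-< m (n<1+n m)) ⟩
        suc (m + suc m)   ≤⟨ +-mono-≤ m<x m<y ⟩
        x + y             ∎
        where open ≤-Reasoning

      1%N≡1 : 1 % N ≡ 1
      1%N≡1 = m<n⇒m%n≡m (≤-trans (+-mono-≤ 1≤m 1≤m) m+m≤N)

      2≤large : ∀ {x} → m < x → 2 ≤ x
      2≤large m<x = ≤-trans (s≤s 1≤m) m<x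

      small+small≡N : ∀ {x y} → x ≤ m → y ≤ m → x + y ≡ N → x ≡ m
      small+small≡N {x} {y} x≤m y≤m x+y≡N = ≤-antisym x≤m (+-cancelʳ-≤ m m x (begin
        m + m   ≤⟨ m+m≤N ⟩
        N       ≡⟨ x+y≡N ⟨
        x + y   ≤⟨ +-monoʳ-≤ x y≤m ⟩
        x + m   ∎))
        where open ≤-Reasoning

      large+large≡1+N : ∀ {x y} → m < x → m < y → x + y ≡ suc N → x ≡ suc m
      large+large≡1+N {x} {y} m<x m<y x+y≡1+N = ≤-antisym (+-cancelˡ-≤ (suc m) x (suc m) (begin
        suc m + x       ≤⟨ +-monoˡ-≤ x m<y ⟩
        y + x           ≡⟨ +-comm y x ⟩
        x + y           ≡⟨ x+y≡1+N ⟩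
        suc N           ≤⟨ s≤s N≤1+m+m ⟩
        suc (suc (m + m)) ≡⟨ cong suc (+-suc m m) ⟨
        suc m + suc m   ∎)) m<x
        where open ≤-Reasoning

    fold-opposite : ∀ {x y} → x < N → y < N → x + y ≡ 0 ⊎ x + y ≡ N → fold x ≡ fold y
    fold-opposite {x} {y} _ _ (inj₁ x+y≡0) rewrite m+n≡0⇒m≡0 x x+y≡0 | m+n≡0⇒n≡0 x x+y≡0 = refl
    fold-opposite {x} {y} x<N y<N (inj₂ x+y≡N) with fold-cases x<N | fold-cases y<N
    ... | inj₁ (x≤m , fx) | inj₁ (y≤m , fy) =
      trans fx (trans (small+small≡N x≤m y≤m x+y≡N)
        (trans (sym (small+small≡N y≤m x≤m (trans (+-comm y x) x+y≡N))) (sym fy)))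
    ... | inj₁ (_ , fx) | inj₂ (_ , fy) = trans fx (+-cancelˡ-≡ y x (fold y) (trans (+-comm y x) (trans x+y≡N (sym fy))))
    ... | inj₂ (_ , fx) | inj₁ (_ , fy) = trans (sym (+-cancelˡ-≡ x y (fold x) (trans x+y≡N (sym fx)))) (sym fy)
    ... | inj₂ (m<x , _) | inj₂ (m<y , _) = contradiction x+y≡N (>⇒≢ (N<large+large m<x m<y))

    ReverseShape : ℕ → ℕ → Set
    ReverseShape x y =
      (fold x ≡ suc (fold y) × x ≡ fold x) ⊎
      (fold y ≡ suc (fold x) × (x ≡ 0 × fold x ≡ 0 ⊎ x + fold x ≡ N)) ⊎
      x ≡ y

    private
      small+small≡1 : ∀ {x y} → x + y ≡ 1 → fold x ≡ x → fold y ≡ y → ReverseShape x y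
      small+small≡1 {0} x+y≡1 fx fy = inj₂ (inj₁ (trans fy x+y≡1 , inj₁ (refl , fx)))
      small+small≡1 {1} x+y≡1 fx fy = inj₁ (trans fx (cong suc (sym (trans fy (suc-injective x+y≡1)))) , sym fx)
      small+small≡1 {suc (suc _)} () _ _

    fold-reverse : ∀ {x y} → x < N → y < N → x + y ≡ 1 ⊎ x + y ≡ suc N → ReverseShape x y
    fold-reverse {x} {y} x<N y<N sum with fold-cases x<N | fold-cases y<N | sum
    ... | inj₁ (_ , fx) | inj₁ (_ , fy) | inj₁ x+y≡1 = small+small≡1 x+y≡1 fx fy
    ... | inj₁ (x≤m , _) | inj₁ (y≤m , _) | inj₂ x+y≡1+N =
      contradiction (≤-trans (+-mono-≤ x≤m y≤m) m+m≤N) (<⇒≱ (≤-reflexive (sym x+y≡1+N)))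
    ... | inj₁ _ | inj₂ (m<y , _) | inj₁ x+y≡1 =
      contradiction x+y≡1 (>⇒≢ (≤-trans (2≤large m<y) (m≤n+m y x)))
    ... | inj₁ (_ , fx) | inj₂ (_ , fy) | inj₂ x+y≡1+N =
      inj₁ (trans fx (+-cancelˡ-≡ y x (suc (fold y)) (begin
        y + x            ≡⟨ +-comm y x ⟩
        x + y            ≡⟨ x+y≡1+N ⟩
        suc N            ≡⟨ cong suc fy ⟨
        suc (y + fold y) ≡⟨ +-suc y (fold y) ⟨
        y + suc (fold y) ∎)) , sym fx)
      where open ≡-Reasoning
    ... | inj₂ (m<x , _) | inj₁ _ | inj₁ x+y≡1 =
      contradiction x+y≡1 (>⇒≢ (≤-trans (2≤large m<x) (m≤m+n x y)))
    ... | inj₂ (_ , fx) | inj₁ (_ , fy) | inj₂ x+y≡1+N =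
      inj₂ (inj₁ (trans fy (+-cancelˡ-≡ x y (suc (fold x)) (begin
        x + y            ≡⟨ x+y≡1+N ⟩
        suc N            ≡⟨ cong suc fx ⟨
        suc (x + fold x) ≡⟨ +-suc x (fold x) ⟨
        x + suc (fold x) ∎)) , inj₂ fx))
      where open ≡-Reasoning
    ... | inj₂ (m<x , _) | inj₂ _ | inj₁ x+y≡1 =
      contradiction x+y≡1 (>⇒≢ (≤-trans (2≤large m<x) (m≤m+n x y)))
    ... | inj₂ (m<x , _) | inj₂ (m<y , _) | inj₂ x+y≡1+N =
      inj₂ (inj₂ (trans (large+large≡1+N m<x m<y x+y≡1+N)
        (sym (large+large≡1+N m<y m<x (trans (+-comm y x) x+y≡1+N)))))

    reverse-cases : ∀ {v w} → E G v w → f v w + f w v ≡ 1 ⊎ f v w + f w v ≡ suc N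
    reverse-cases {v} {w} e
      with m<n+n⇒m≡m%n⊎m≡m%n+n (+-mono-< (bounded v w) (bounded w v))
    ... | inj₁ s≡ = inj₁ (trans s≡ (trans (reverseSum≡1 e) 1%N≡1))
    ... | inj₂ s≡ = inj₂ (trans s≡ (cong (_+ N) (trans (reverseSum≡1 e) 1%N≡1)))

    private
      in-sum%N≡0 : ∀ {u u′ w} → E G u w → E G u′ w → u ≢ u′ → (f u w + f u′ w) % N ≡ 0
      in-sum%N≡0 {u} {u′} {w} e e′ u≢u′ = trans (+-cancelˡ-% 1 N (begin
        (1 + (f u w + f u′ w)) % N      ≡⟨ cong (_% N) (+-suc (f u w) (f u′ w)) ⟨
        (f u w + suc (f u′ w)) % N      ≡⟨ [m+n%d]%d≡[m+n]%d (f u w) (suc (f u′ w)) N ⟨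
        (f u w + suc (f u′ w) % N) % N  ≡⟨ cong (λ x → (f u w + x) % N) (periodic e′ (E-sym e) u≢u′) ⟨
        (f u w + f w u) % N             ≡⟨ reverseSum≡1 e ⟩
        1 % N                           ∎)) (0%n≡0 N)
        where open ≡-Reasoning

    opposite-in : ∀ {u u′ w} → E G u w → E G u′ w → u ≢ u′ → f u w + f u′ w ≡ 0 ⊎ f u w + f u′ w ≡ N
    opposite-in {u} {u′} {w} e e′ u≢u′ with m<n+n⇒m≡m%n⊎m≡m%n+n (+-mono-< (bounded u w) (bounded u′ w))
    ... | inj₁ s≡ = inj₁ (trans s≡ (in-sum%N≡0 e e′ u≢u′))
    ... | inj₂ s≡ = inj₂ (trans s≡ (cong (_+ N) (in-sum%N≡0 e e′ u≢u′)))

    height : Fin n → ℕ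
    height w = fold (f (proj₁ (inEdge w)) w)

    height-fold : ∀ {v w} → E G v w → height w ≡ fold (f v w)
    height-fold {v} {w} e with proj₁ (inEdge w) ≟ᶠ v
    ... | yes refl = refl
    ... | no u≢v = fold-opposite (bounded _ w) (bounded v w) (opposite-in (proj₂ (inEdge w)) e u≢v)

    shape : ∀ {v w} → E G v w →
      (height w ≡ suc (height v) × f v w ≡ height w) ⊎
      (height v ≡ suc (height w) × (f v w ≡ 0 × height w ≡ 0 ⊎ f v w + height w ≡ N)) ⊎
      f v w ≡ f w v
    shape {v} {w} e rewrite height-fold e | height-fold (E-sym e) =
      fold-reverse (bounded v w) (bounded w v) (reverse-cases e)

    flat-height : ∀ {v w} → E G v w → f v w ≡ f w v → height v ≡ height w
    flat-height e flat = trans (height-fold (E-sym e)) (trans (cong fold (sym flat)) (sym (height-fold e)))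

    height-step : ∀ {v w} → E G v w → f v w ≢ f w v → height w ≡ suc (height v) ⊎ height v ≡ suc (height w)
    height-step e not-flat with shape e
    ... | inj₁ (up , _) = inj₁ up
    ... | inj₂ (inj₁ (down , _)) = inj₂ down
    ... | inj₂ (inj₂ flat) = contradiction flat not-flat

    rising-label : ∀ {v w} → E G v w → height w ≡ suc (height v) → f v w ≡ height w
    rising-label e up with shape e
    ... | inj₁ (_ , label) = label
    ... | inj₂ (inj₁ (down , _)) = contradiction down (m≡1+n⇒n≢1+m up)
    ... | inj₂ (inj₂ flat) = contradiction (trans (flat-height e flat) up) (1+n≢n ∘ sym)

    falling-label : ∀ {v w} → E G v w → height v ≡ suc (height w) →
      f v w ≡ 0 × height w ≡ 0 ⊎ f v w + height w ≡ N
    falling-label e down with shape e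
    ... | inj₁ (up , _) = contradiction down (m≡1+n⇒n≢1+m up)
    ... | inj₂ (inj₁ (_ , label)) = label
    ... | inj₂ (inj₂ flat) = contradiction (trans (sym (flat-height e flat)) down) (1+n≢n ∘ sym)

module Classes {n : ℕ} {G : Graph n} {k : ℕ} (P : CircularlyPartite G k) where
  open CircularlyPartite P
  open Walks G

  instance
    k≢0 : NonZero k
    k≢0 = k-nonzero

  private
    labelBy : ∀ v w b → adj G v w ≡ b → ℕ
    labelBy v w true e = toℕ (col v w e)
    labelBy v w false _ = 0

    labelBy-col : ∀ {v w} b (p : adj G v w ≡ b) (e : E G v w) → labelBy v w b p ≡ toℕ (col v w e)
    labelBy-col true p e = cong (toℕ ∘ col _ _) (Decidable⇒UIP.≡-irrelevant Bool._≟_ p e)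
    labelBy-col false p e = contradiction (trans (sym e) p) λ ()

    labelBy<k : ∀ v w b (p : adj G v w ≡ b) → labelBy v w b p < k
    labelBy<k v w true e = toℕ<n (col v w e)
    labelBy<k v w false _ = >-nonZero⁻¹ k

  label : Fin n → Fin n → ℕ
  label v w = labelBy v w (adj G v w) refl

  label-col : ∀ {v w} (e : E G v w) → label v w ≡ toℕ (col v w e)
  label-col {v} {w} = labelBy-col (adj G v w) refl

  label<k : ∀ v w → label v w < k
  label<k v w = labelBy<k v w (adj G v w) refl

  label-periodic : ∀ {v w z} → E G v w → E G w z → z ≢ v → label w z ≡ suc (label v w) % k
  label-periodic {v} {w} {z} e e′ z≢v = begin
    label w z                ≡⟨ label-col e′ ⟩
    toℕ (col w z e′)         ≡⟨ periodic v w z e e′ z≢v ⟩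
    suc (toℕ (col v w e)) % k ≡⟨ cong (λ x → suc x % k) (label-col e) ⟨
    suc (label v w) % k      ∎
    where open ≡-Reasoning

  label-onto : ∀ j → j < k → ∃₂ λ v w → E G v w × label v w ≡ j
  label-onto j j<k with nonempty (fromℕ< j<k)
  ... | v , w , e , eq = v , w , e , trans (label-col e) (trans (cong toℕ eq) (toℕ-fromℕ< j<k))

  anEdge : ∃₂ λ v w → E G v w
  anEdge with label-onto 0 (>-nonZero⁻¹ k)
  ... | v , w , e , _ = v , w , e

  label-nonBacktracking : ∀ {x u y w} (e : E G x u) (r : Reach G u y) (e′ : E G y w) →
    NonBacktracking (step e (r ∷ʳ e′)) → label y w ≡ (label x u + length (r ∷ʳ e′)) % k
  label-nonBacktracking {x} {u} e here e′ (x≢w , _) =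
    trans (label-periodic e e′ (x≢w ∘ sym)) (cong (_% k) (+-comm 1 (label x u)))
  label-nonBacktracking {x} {u} {y} {w} e (step {v = u₂} e″ r) e′ (x≢u₂ , nb) = begin
    label y w                                   ≡⟨ label-nonBacktracking e″ r e′ nb ⟩
    (label u u₂ + L) % k                        ≡⟨ cong (λ a → (a + L) % k) (label-periodic e e″ (x≢u₂ ∘ sym)) ⟩
    (suc (label x u) % k + L) % k               ≡⟨ [m%d+n]%d≡[m+n]%d (suc (label x u)) L k ⟩
    (suc (label x u) + L) % k                   ≡⟨ cong (_% k) (+-suc (label x u) L) ⟨
    (label x u + suc L) % k                     ∎
    where
    open ≡-Reasoning
    L = length (r ∷ʳ e′)

  cycle-length : ∀ {y x} (e : E G y x) (c : Reach G x y) → NonBacktracking (step e (c ∷ʳ e)) →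
    k ∣ length (c ∷ʳ e)
  cycle-length {y} {x} e c nb = m%n≡0⇒n∣m L k (trans (+-cancelˡ-% (label y x) k (begin
    (label y x + L) % k  ≡⟨ label-nonBacktracking e c e nb ⟨
    label y x            ≡⟨ m<n⇒m%n≡m (label<k y x) ⟨
    label y x % k        ≡⟨ cong (_% k) (+-identityʳ (label y x)) ⟨
    (label y x + 0) % k  ∎)) (0%n≡0 k))
    where
    open ≡-Reasoning
    L = length (c ∷ʳ e)

  2∣k⇒evenClosedWalks : 2 ∣ k → ∀ {u} (r : Reach G u u) → parity (length r) ≡ 0ℙ
  2∣k⇒evenClosedWalks 2∣k r with parity (length r) in eq
  ... | 0ℙ = refl
  ... | 1ℙ with removeBacktracking r
  ... | r′ , nb , same with cyclicallyReduce r′ nb (trans same eq)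
  ... | _ , _ , e , c , nb′ , odd =
    contradiction (trans (sym (parity-even (∣-trans 2∣k (cycle-length e c nb′)))) odd) λ ()

  reverseSum : Fin n → Fin n → ℕ
  reverseSum v w = (label v w + label w v) % k

  private
    reverseSum-via : ∀ {v w z} → E G v w → E G z w → v ≢ z → reverseSum v w ≡ suc (label v w + label z w) % k
    reverseSum-via {v} {w} {z} e e′ v≢z = begin
      (label v w + label w v) % k            ≡⟨ cong (λ x → (label v w + x) % k) (label-periodic e′ (E-sym e) v≢z) ⟩
      (label v w + suc (label z w) % k) % k  ≡⟨ [m+n%d]%d≡[m+n]%d (label v w) (suc (label z w)) k ⟩
      (label v w + suc (label z w)) % k      ≡⟨ cong (_% k) (+-suc (label v w) (label z w)) ⟩
      suc (label v w + label z w) % k        ∎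
      where open ≡-Reasoning

    reverseSum-sym : ∀ v w → reverseSum v w ≡ reverseSum w v
    reverseSum-sym v w = cong (_% k) (+-comm (label v w) (label w v))

    reverseSum-adjacent : ∀ {x y z} → E G x y → E G y z → reverseSum x y ≡ reverseSum y z
    reverseSum-adjacent {x} {y} {z} e e′ with z ≟ᶠ x
    ... | yes refl = reverseSum-sym x y
    ... | no z≢x = begin
      reverseSum x y                 ≡⟨ reverseSum-via e (E-sym e′) (z≢x ∘ sym) ⟩
      suc (label x y + label z y) % k ≡⟨ cong (λ a → suc a % k) (+-comm (label x y) (label z y)) ⟩
      suc (label z y + label x y) % k ≡⟨ reverseSum-via (E-sym e′) e z≢x ⟨
      reverseSum z y                 ≡⟨ reverseSum-sym z y ⟩
      reverseSum y z                 ∎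
      where open ≡-Reasoning

    reverseSum-along : ∀ {x y v w} → Reach G y v → E G x y → E G v w → reverseSum x y ≡ reverseSum v w
    reverseSum-along here e e′ = reverseSum-adjacent e e′
    reverseSum-along (step e″ r) e e′ = trans (reverseSum-adjacent e e″) (reverseSum-along r e″ e′)

  reverseSum-constant : Connected G → ∀ {v w v′ w′} → E G v w → E G v′ w′ → reverseSum v w ≡ reverseSum v′ w′
  reverseSum-constant conn {w = w} {v′} e e′ = reverseSum-along (conn w v′) e e′

module Normalise {n : ℕ} {G : Graph n} (conn : Connected G) {M : ℕ}
  (P : CircularlyPartite G (suc (M + M))) where

  open Labellings G
  open Classes P

  k : ℕ
  k = suc (M + M)

  private
    v₀ w₀ : Fin n
    v₀ = proj₁ anEdge
    w₀ = proj₁ (proj₂ anEdge)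

    e₀ : E G v₀ w₀
    e₀ = proj₂ (proj₂ anEdge)

    S : ℕ
    S = reverseSum v₀ w₀

    -- suc M is the inverse of 2 modulo k, so S + 2·shift ≡ 1.
    shift : ℕ
    shift = suc M * (suc k ∸ S)

    S+2shift : (S + (shift + shift)) % k ≡ 1 % k
    S+2shift = begin
      (S + (shift + shift)) % k                    ≡⟨ cong (λ x → (S + x) % k) (*-distribʳ-+ D (suc M) (suc M)) ⟨
      (S + (suc M + suc M) * D) % k                ≡⟨ cong (λ x → (S + suc x * D) % k) (+-suc M M) ⟩
      (S + (D + k * D)) % k                        ≡⟨ cong (_% k) (+-assoc S D (k * D)) ⟨
      (S + D + k * D) % k                          ≡⟨ cong (λ x → (x + k * D) % k) (m+[n∸m]≡n S≤1+k) ⟩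
      (1 + (k + k * D)) % k                        ≡⟨ cong (λ x → (1 + (k + x)) % k) (*-comm k D) ⟩
      (1 + suc D * k) % k                          ≡⟨ [m+kn]%n≡m%n 1 (suc D) k ⟩
      1 % k                                        ∎
      where
      open ≡-Reasoning
      D = suc k ∸ S
      S≤1+k : S ≤ suc k
      S≤1+k = ≤-trans (<⇒≤ (m%n<n (label v₀ w₀ + label w₀ v₀) k)) (n≤1+n k)

  t : Fin n → Fin n → ℕ
  t v w = (label v w + shift) % k

  t-normalised : Normalised k t
  t-normalised = record
    { bounded = λ v w → m%n<n (label v w + shift) k
    ; periodic = periodic
    ; reverseSum≡1 = reverseSum≡1
    }
    where
    open ≡-Reasoning
    periodic : ∀ {v w z} → E G v w → E G w z → z ≢ v → t w z ≡ suc (t v w) % k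
    periodic {v} {w} {z} e e′ z≢v = begin
      (label w z + shift) % k                  ≡⟨ cong (λ x → (x + shift) % k) (label-periodic e e′ z≢v) ⟩
      (suc (label v w) % k + shift) % k        ≡⟨ [m%d+n]%d≡[m+n]%d (suc (label v w)) shift k ⟩
      (1 + (label v w + shift)) % k            ≡⟨ [m+n%d]%d≡[m+n]%d 1 (label v w + shift) k ⟨
      suc (t v w) % k                          ∎
    reverseSum≡1 : ∀ {v w} → E G v w → (t v w + t w v) % k ≡ 1 % k
    reverseSum≡1 {v} {w} e = begin
      ((label v w + shift) % k + (label w v + shift) % k) % k ≡⟨ %-distribˡ-+ (label v w + shift) (label w v + shift) k ⟨
      ((label v w + shift) + (label w v + shift)) % k         ≡⟨ cong (_% k) (+-interchange (label v w) shift (label w v) shift) ⟩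
      ((label v w + label w v) + (shift + shift)) % k         ≡⟨ [m%d+n]%d≡[m+n]%d (label v w + label w v) (shift + shift) k ⟨
      (reverseSum v w + (shift + shift)) % k                  ≡⟨ cong (λ x → (x + (shift + shift)) % k) (reverseSum-constant conn e e₀) ⟩
      (S + (shift + shift)) % k                               ≡⟨ S+2shift ⟩
      1 % k                                                   ∎

  t-onto : ∀ j → j < k → ∃₂ λ v w → E G v w × t v w ≡ j
  t-onto j j<k with label-onto ((j + (k ∸ shift % k)) % k) (m%n<n (j + (k ∸ shift % k)) k)
  ... | v , w , e , eq = v , w , e , (begin
    (label v w + shift) % k                          ≡⟨ cong (λ x → (x + shift) % k) eq ⟩
    ((j + c) % k + shift) % k                        ≡⟨ [m%d+n]%d≡[m+n]%d (j + c) shift k ⟩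
    (j + c + shift) % k                              ≡⟨ cong (_% k) (rearrange j c shift) ⟩
    (c + (shift + j)) % k                            ≡⟨ [d∸a%d+[a+z]]%d≡z%d shift j k ⟩
    j % k                                            ≡⟨ m<n⇒m%n≡m j<k ⟩
    j                                                ∎)
    where
    open ≡-Reasoning
    c = k ∸ shift % k
    rearrange : ∀ a b d → a + b + d ≡ b + (d + a)
    rearrange a b d = trans (+-assoc a b d) (trans (+-comm a (b + d)) (+-assoc b d a))

module ThreeColouring {n : ℕ} {G : Graph n} (conn : Connected G) {M : ℕ} (1≤M : 1 ≤ M)
  (P : CircularlyPartite G (suc (M + M))) where

  open Walks G
  open Colourings G
  open Labellings G
  open Normalise conn {M} P
  open Height t-normalised M (n≤1+n (M + M)) ≤-refl 1≤M
    (inNeighbour conn (proj₂ (proj₂ (Classes.anEdge P))))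

  Flat : Fin n → Fin n → Set
  Flat u w = t u w ≡ t w u

  flat-double : ∀ {u w} → E G u w → Flat u w → t u w + t u w ≡ suc k
  flat-double {u} {w} e flat with reverse-cases e
  ... | inj₁ sum≡1 = contradiction (trans (cong (t u w +_) flat) sum≡1) (m+m≢1 (t u w))
  ... | inj₂ sum≡1+k = trans (cong (t u w +_) flat) sum≡1+k

  flat-value : ∀ {u w u′ w′} → E G u w → E G u′ w′ → Flat u w → Flat u′ w′ → t u w ≡ t u′ w′
  flat-value e e′ flat flat′ = m+m≡n+n⇒m≡n (trans (flat-double e flat) (sym (flat-double e′ flat′)))

  flat-matching : ∀ {u u′ w} → E G u w → E G u′ w → Flat u w → Flat u′ w → u ≡ u′
  flat-matching {u} {u′} {w} e e′ flat flat′ with u ≟ᶠ u′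
  ... | yes u≡u′ = u≡u′
  ... | no u≢u′ with opposite-in e e′ u≢u′
  ... | inj₁ sum≡0 = contradiction (trans (sym double) sum≡0) λ ()
    where double = trans (cong (t u w +_) (flat-value e′ e flat′ flat)) (flat-double e flat)
  ... | inj₂ sum≡k = contradiction (trans (sym double) sum≡k) 1+n≢n
    where double = trans (cong (t u w +_) (flat-value e′ e flat′ flat)) (flat-double e flat)

  Special : Fin n → Set
  Special w = ∃ λ u → E G u w × Flat u w × toℕ w < toℕ u

  special? : ∀ w → Dec (Special w)
  special? w = any? λ u → E? u w ×-dec t u w ≟ t w u ×-dec toℕ w <? toℕ u

  flat⇒special : ∀ {v w} → E G v w → Flat v w → Special v ⊎ Special w
  flat⇒special {v} {w} e flat with <-cmp (toℕ v) (toℕ w)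
  ... | tri< v<w _ _ = inj₁ (w , E-sym e , sym flat , v<w)
  ... | tri≈ _ v≡w _ = contradiction (toℕ-injective v≡w) (E-irrefl e)
  ... | tri> _ _ w<v = inj₂ (v , e , flat , w<v)

  not-both-special : ∀ {v w} → E G v w → Special v → Special w → ⊥
  not-both-special {v} {w} e (u , eu , flat-u , v<u) (u′ , eu′ , flat-u′ , w<u′) =
    <-asym (subst (λ x → toℕ v < toℕ x) (flat-matching eu (E-sym e) flat-u (sym flat-vw)) v<u)
           (subst (λ x → toℕ w < toℕ x) (flat-matching eu′ e flat-u′ flat-vw) w<u′)
    where
    same-height : height v ≡ height w
    same-height = trans (height-fold eu) (trans (cong fold (flat-value eu eu′ flat-u flat-u′)) (sym (height-fold eu′)))
    flat-vw : Flat v w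
    flat-vw with t v w ≟ t w v
    ... | yes flat = flat
    ... | no not-flat with height-step e not-flat
    ... | inj₁ up = contradiction (trans up (cong suc same-height)) (1+n≢n ∘ sym)
    ... | inj₂ down = contradiction (trans (sym same-height) down) (1+n≢n ∘ sym)

  -- Heights differ by one except across flat edges, which form a matching; one end
  -- of each flat edge gets the third colour.
  colour : Fin n → Fin 3
  colour w with special? w
  ... | yes _ = fromℕ 2
  ... | no _ = inject₁ (parityColour (parity (height w)))

  colour-proper : ∀ v w → E G v w → colour v ≢ colour w
  colour-proper v w e with special? v | special? w
  ... | yes sv | yes sw = contradiction (not-both-special e sv sw) λ ()
  ... | yes _ | no _ = fromℕ≢inject₁
  ... | no _ | yes _ = fromℕ≢inject₁ ∘ sym
  ... | no ¬sv | no ¬sw = parities-differ ∘ parityColour-injective ∘ inject₁-injective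
    where
    parities-differ : parity (height v) ≢ parity (height w)
    parities-differ with t v w ≟ t w v
    ... | yes flat = contradiction (flat⇒special e flat) λ { (inj₁ sv) → ¬sv sv ; (inj₂ sw) → ¬sw sw }
    ... | no not-flat with height-step e not-flat
    ... | inj₁ up = parity-step up ∘ sym
    ... | inj₂ down = parity-step down

  3-colourable : Colourable G 3
  3-colourable = colour , colour-proper

module Lift {n : ℕ} {G : Graph n} (conn : Connected G) {M : ℕ} (1≤M : 1 ≤ M)
  (P : CircularlyPartite G (suc (M + M)))
  (σ : Fin n → Parity) (σ-proper : ∀ {v w} → E G v w → σ w ≡ σ v ⁻¹) where

  open Walks G
  open Labellings G
  open Normalise conn {M} P
  open Normalised t-normalised
    renaming (bounded to t<k; periodic to t-periodic; reverseSum≡1 to t-reverseSum≡1)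

  private
    base : ∃₂ λ v w → E G v w × t v w ≡ 0
    base = t-onto 0 (s≤s z≤n)

    a q₀ : Fin n
    a = proj₁ base
    q₀ = proj₁ (proj₂ base)

    a→q₀ : E G a q₀
    a→q₀ = proj₁ (proj₂ (proj₂ base))

    -- recoloured so that X a q₀ = 0, giving a vertex of height 0
    σ₀ : Fin n → Parity
    σ₀ v = σ v ℙ.+ σ a

    σ₀-proper : ∀ {v w} → E G v w → σ₀ w ≡ σ₀ v ⁻¹
    σ₀-proper {v} e = trans (cong (ℙ._+ σ a) (σ-proper e)) (⁻¹-+ (σ v) (σ a))

    parity-k : parity k ≡ 1ℙ
    parity-k = parity-1+m+m M

  -- the unique y < k + k with y ≡ x (mod k) and parity p (k is odd)
  lift : Parity → ℕ → ℕ
  lift p x with parity x ℙₚ.≟ p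
  ... | yes _ = x
  ... | no _ = k + x

  lift-cases : ∀ p x → lift p x ≡ x ⊎ lift p x ≡ k + x
  lift-cases p x with parity x ℙₚ.≟ p
  ... | yes _ = inj₁ refl
  ... | no _ = inj₂ refl

  lift-parity : ∀ p x → parity (lift p x) ≡ p
  lift-parity p x with parity x ℙₚ.≟ p
  ... | yes eq = eq
  ... | no ne = trans (ℙₚ.+-homo-+ k x) (trans (cong (ℙ._+ parity x) parity-k) (p≢q⇒p⁻¹≡q ne))

  lift-% : ∀ p {x} → x < k → lift p x % k ≡ x
  lift-% p {x} x<k with parity x ℙₚ.≟ p
  ... | yes _ = m<n⇒m%n≡m x<k
  ... | no _ = trans (cong (_% k) (+-comm k x)) (trans ([m+n]%n≡m%n x k) (m<n⇒m%n≡m x<k))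

  lift< : ∀ p {x} → x < k → lift p x < k + k
  lift< p {x} x<k with parity x ℙₚ.≟ p
  ... | yes _ = ≤-trans x<k (m≤m+n k k)
  ... | no _ = +-monoʳ-< k x<k

  X : Fin n → Fin n → ℕ
  X v w = lift (σ₀ v) (t v w)

  private
    X<2k : ∀ v w → X v w < k + k
    X<2k v w = lift< (σ₀ v) (t<k v w)

    X%k : ∀ v w → X v w % k ≡ t v w
    X%k v w = lift-% (σ₀ v) (t<k v w)

    %[k+k]%k : ∀ z → z % (k + k) % k ≡ z % k
    %[k+k]%k z = m∣n⇒o%n%m≡o%m k (k + k) z (∣m∣n⇒∣m+n ∣-refl ∣-refl)

    parity-%[k+k] : ∀ z → parity (z % (k + k)) ≡ parity z
    parity-%[k+k] z = parity-%-even z (k + k) (parity-m+m k)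

    same : ∀ {x y} → x < k + k → y < k + k → x % k ≡ y % k → parity x ≡ parity y → x ≡ y
    same = residue-parity-injective parity-k

  X-normalised : Normalised (k + k) X
  X-normalised = record
    { bounded = X<2k
    ; periodic = periodic
    ; reverseSum≡1 = reverseSum≡1
    }
    where
    open ≡-Reasoning
    periodic : ∀ {v w z} → E G v w → E G w z → z ≢ v → X w z ≡ suc (X v w) % (k + k)
    periodic {v} {w} {z} e e′ z≢v = same (X<2k w z) (m%n<n (suc (X v w)) (k + k))
      (begin
        X w z % k                      ≡⟨ X%k w z ⟩
        t w z                          ≡⟨ t-periodic e e′ z≢v ⟩
        suc (t v w) % k                ≡⟨ cong (λ x → suc x % k) (X%k v w) ⟨
        suc (X v w % k) % k            ≡⟨ [m+n%d]%d≡[m+n]%d 1 (X v w) k ⟩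
        suc (X v w) % k                ≡⟨ %[k+k]%k (suc (X v w)) ⟨
        suc (X v w) % (k + k) % k      ∎)
      (begin
        parity (X w z)                 ≡⟨ lift-parity (σ₀ w) (t w z) ⟩
        σ₀ w                           ≡⟨ σ₀-proper e ⟩
        σ₀ v ⁻¹                        ≡⟨ cong _⁻¹ (lift-parity (σ₀ v) (t v w)) ⟨
        parity (X v w) ⁻¹              ≡⟨ parity-suc (X v w) ⟨
        parity (suc (X v w))           ≡⟨ parity-%[k+k] (suc (X v w)) ⟨
        parity (suc (X v w) % (k + k)) ∎)
    reverseSum≡1 : ∀ {v w} → E G v w → (X v w + X w v) % (k + k) ≡ 1 % (k + k)
    reverseSum≡1 {v} {w} e = same (m%n<n (X v w + X w v) (k + k)) (m%n<n 1 (k + k))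
      (begin
        (X v w + X w v) % (k + k) % k  ≡⟨ %[k+k]%k (X v w + X w v) ⟩
        (X v w + X w v) % k            ≡⟨ %-distribˡ-+ (X v w) (X w v) k ⟩
        (X v w % k + X w v % k) % k    ≡⟨ cong₂ (λ x y → (x + y) % k) (X%k v w) (X%k w v) ⟩
        (t v w + t w v) % k            ≡⟨ t-reverseSum≡1 e ⟩
        1 % k                          ≡⟨ %[k+k]%k 1 ⟨
        1 % (k + k) % k                ∎)
      (begin
        parity ((X v w + X w v) % (k + k)) ≡⟨ parity-%[k+k] (X v w + X w v) ⟩
        parity (X v w + X w v)             ≡⟨ ℙₚ.+-homo-+ (X v w) (X w v) ⟩
        parity (X v w) ℙ.+ parity (X w v)  ≡⟨ cong₂ ℙ._+_ (lift-parity (σ₀ v) (t v w)) (lift-parity (σ₀ w) (t w v)) ⟩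
        σ₀ v ℙ.+ σ₀ w                      ≡⟨ cong (σ₀ v ℙ.+_) (σ₀-proper e) ⟩
        σ₀ v ℙ.+ σ₀ v ⁻¹                   ≡⟨ ℙₚ.p+p⁻¹≡1ℙ (σ₀ v) ⟩
        1ℙ                                 ≡⟨ parity-%[k+k] 1 ⟨
        parity (1 % (k + k))               ∎)

  open Normalised X-normalised using () renaming (periodic to X-periodic)

  X-not-flat : ∀ {v w} → E G v w → X v w ≢ X w v
  X-not-flat {v} {w} e eq = ℙₚ.p≢p⁻¹ (σ₀ v) (begin
    σ₀ v            ≡⟨ lift-parity (σ₀ v) (t v w) ⟨
    parity (X v w)  ≡⟨ cong parity eq ⟩
    parity (X w v)  ≡⟨ lift-parity (σ₀ w) (t w v) ⟩
    σ₀ w            ≡⟨ σ₀-proper e ⟩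
    σ₀ v ⁻¹         ∎)
    where open ≡-Reasoning

  open Height X-normalised k ≤-refl (n≤1+n (k + k)) (s≤s z≤n) (inNeighbour conn a→q₀)

  height-adjacent : ∀ {v w} → E G v w → height w ≡ suc (height v) ⊎ height v ≡ suc (height w)
  height-adjacent e = height-step e (X-not-flat e)

  ground : height q₀ ≡ 0
  ground = trans (height-fold a→q₀)
    (trans (cong fold (cong₂ lift (ℙₚ.p+p≡0ℙ (σ a)) (proj₂ (proj₂ (proj₂ base))))) (fold-small z≤n))

  private
    k+1+M-head : ∀ {v w} → E G v w → X v w ≡ k + suc M → height w ≡ M
    k+1+M-head {v} {w} e X≡k+1+M = trans (height-fold e)
      (+-cancelˡ-≡ (suc M) (fold (X v w)) M (+-cancelˡ-≡ k (suc M + fold (X v w)) k (begin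
      k + (suc M + fold (X v w))  ≡⟨ +-assoc k (suc M) (fold (X v w)) ⟨
      k + suc M + fold (X v w)    ≡⟨ cong (_+ fold (X v w)) X≡k+1+M ⟨
      X v w + fold (X v w)        ≡⟨ fold-large (X<2k v w) (subst (k <_) (sym X≡k+1+M) (m<m+n k z<s)) ⟩
      k + k                       ∎)))
      where open ≡-Reasoning

    k+1+M-tail : ∀ {v w} → E G v w → X v w ≡ k + suc M → height v ≡ suc M
    k+1+M-tail {v} {w} e X≡k+1+M = [ rising , falling ]′ (height-adjacent e)
      where
      rising : height w ≡ suc (height v) → height v ≡ suc M
      rising up = contradiction (trans (sym X≡k+1+M) (trans (rising-label e up) (k+1+M-head e X≡k+1+M)))
        (<⇒≢ (≤-trans (n<1+n M) (m≤n+m (suc M) k)) ∘ sym)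
      falling : height v ≡ suc (height w) → height v ≡ suc M
      falling down = trans down (cong suc (k+1+M-head e X≡k+1+M))

  summit : ∃ λ q → height q ≡ suc M
  summit = from (t-onto (suc M) (s≤s (m<m+n M 1≤M)))
    where
    from : (∃₂ λ v w → E G v w × t v w ≡ suc M) → ∃ λ q → height q ≡ suc M
    from (v , w , e , t≡1+M) = [ low , high ]′ (lift-cases (σ₀ v) (t v w))
      where
      low : X v w ≡ t v w → ∃ λ q → height q ≡ suc M
      low X≡t = w , trans (height-fold e) (trans (cong fold (trans X≡t t≡1+M)) (fold-small (s≤s (m≤m+n M M))))
      high : X v w ≡ k + t v w → ∃ λ q → height q ≡ suc M
      high X≡k+t = v , k+1+M-tail e (trans X≡k+t (cong (k +_) t≡1+M))

  private
    rise : ∀ {q j} → j < height q → ∃₂ λ v w → E G v w × height v ≡ j × height w ≡ suc j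
    rise {q} = intermediateEdge height height-adjacent (conn q₀ q) (subst (_≤ _) (sym ground) z≤n)

    X-rising : ∀ {q j} → j < height q → ∃₂ λ v w → E G v w × X v w ≡ suc j
    X-rising j<hq = from (rise j<hq)
      where
      from : ∀ {j} → (∃₂ λ v w → E G v w × height v ≡ j × height w ≡ suc j) → ∃₂ λ v w → E G v w × X v w ≡ suc j
      from (v , w , e , hv , hw) = v , w , e , trans (rising-label e (trans hw (cong suc (sym hv)))) hw

    X-falling : ∀ {q j} → j < height q → ∃₂ λ v w → E G v w × X v w ≡ (k + k ∸ j) % (k + k)
    X-falling j<hq = from (rise j<hq)
      where
      from : ∀ {j} → (∃₂ λ v w → E G v w × height v ≡ j × height w ≡ suc j) →
        ∃₂ λ v w → E G v w × X v w ≡ (k + k ∸ j) % (k + k)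
      from (v , w , e , hv , hw) = w , v , E-sym e , x+j≡N⇒x≡[N∸j]%N (X<2k w v)
        (subst (λ h → X w v ≡ 0 × h ≡ 0 ⊎ X w v + h ≡ k + k) hv (falling-label (E-sym e) (trans hw (cong suc (sym hv)))))

  partA : ∀ {q} → height q ≡ k → CircularlyPartite G (k + k)
  partA {q} hq = fromLabelling X
    (λ {v} {w} {z} e e′ z≢v → trans (m<n⇒m%n≡m (X<2k w z)) (X-periodic e e′ z≢v))
    (λ j j<2k → let v , w , e , X≡j = hit j j<2k in v , w , e , trans (m<n⇒m%n≡m (X<2k v w)) X≡j)
    where
    below : ∀ {j} → j < k → j < height q
    below {j} = subst (j <_) (sym hq)

    hit : ∀ j → j < k + k → ∃₂ λ v w → E G v w × X v w ≡ j
    hit zero _ = let v , w , e , X≡ = X-falling (below z<s) in v , w , e , trans X≡ (n%n≡0 (k + k))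
    hit (suc j) 1+j<2k = by-size (suc j ≤? k)
      where
      by-size : Dec (suc j ≤ k) → ∃₂ λ v w → E G v w × X v w ≡ suc j
      by-size (yes 1+j≤k) = X-rising (below 1+j≤k)
      by-size (no 1+j≰k) = let v , w , e , X≡ = X-falling (below i<k) in
        v , w , e , trans X≡ (trans (cong (_% (k + k)) (m∸[m∸n]≡n (<⇒≤ 1+j<2k))) (m<n⇒m%n≡m 1+j<2k))
        where
        i<k : k + k ∸ suc j < k
        i<k = +-cancelʳ-< k _ k (begin-strict
          k + k ∸ suc j + k     <⟨ +-monoʳ-< (k + k ∸ suc j) (≰⇒> 1+j≰k) ⟩
          k + k ∸ suc j + suc j ≡⟨ m∸n+n≡m (<⇒≤ 1+j<2k) ⟩
          k + k                 ∎)
          where open ≤-Reasoning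

  private
    Z : Fin n → Fin n → ℕ
    Z v w = (X v w + (M + M)) % (k + k)

    below-summit : ∀ {j} → j < suc M → j < height (proj₁ summit)
    below-summit {j} = subst (j <_) (sym (proj₂ summit))

    Z-rising : ∀ {j} → j < suc M → ∃₂ λ v w → E G v w × Z v w ≡ suc j + (M + M)
    Z-rising {j} j<1+M = let v , w , e , X≡1+j = X-rising (below-summit j<1+M) in v , w , e ,
      trans (cong (λ x → (x + (M + M)) % (k + k)) X≡1+j)
            (m<n⇒m%n≡m (+-mono-≤-< (≤-trans j<1+M (s≤s (m≤m+n M M))) (n<1+n (M + M))))

    Z-falling : ∀ {j} → j < suc M → ∃₂ λ v w → E G v w × Z v w ≡ M + M ∸ j
    Z-falling {j} j<1+M = let v , w , e , X≡ = X-falling (below-summit j<1+M) in v , w , e , (begin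
      (X v w + (M + M)) % (k + k)                 ≡⟨ cong (λ x → (x + (M + M)) % (k + k)) X≡ ⟩
      ((k + k ∸ j) % (k + k) + (M + M)) % (k + k) ≡⟨ [m%d+n]%d≡[m+n]%d (k + k ∸ j) (M + M) (k + k) ⟩
      (k + k ∸ j + (M + M)) % (k + k)             ≡⟨ cong (_% (k + k)) rearranged ⟩
      (M + M ∸ j + (k + k)) % (k + k)             ≡⟨ [m+n]%n≡m%n (M + M ∸ j) (k + k) ⟩
      (M + M ∸ j) % (k + k)                       ≡⟨ m<n⇒m%n≡m (≤-<-trans (m∸n≤m (M + M) j) (≤-trans (n<1+n (M + M)) (m≤m+n k k))) ⟩
      M + M ∸ j                                   ∎)
      where
      open ≡-Reasoning
      j≤2M : j ≤ M + M
      j≤2M = ≤-trans (≤-pred j<1+M) (m≤m+n M M)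
      rearranged : k + k ∸ j + (M + M) ≡ M + M ∸ j + (k + k)
      rearranged = begin
        k + k ∸ j + (M + M)   ≡⟨ +-∸-comm (M + M) (≤-trans j≤2M (≤-trans (n≤1+n (M + M)) (m≤m+n k k))) ⟨
        k + k + (M + M) ∸ j   ≡⟨ cong (_∸ j) (+-comm (k + k) (M + M)) ⟩
        M + M + (k + k) ∸ j   ≡⟨ +-∸-comm (k + k) j≤2M ⟩
        M + M ∸ j + (k + k)   ∎

    Z-onto : ∀ J → J < suc k → ∃₂ λ v w → E G v w × Z v w % suc k ≡ J
    Z-onto J J<1+k = by-size (J <? M) (J ≤? M + M)
      where
      by-size : Dec (J < M) → Dec (J ≤ M + M) → ∃₂ λ v w → E G v w × Z v w % suc k ≡ J
      by-size (yes J<M) _ = let v , w , e , Z≡ = Z-rising (s≤s J<M) in v , w , e , (begin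
        Z v w % suc k                          ≡⟨ cong (_% suc k) Z≡ ⟩
        (suc (suc J) + (M + M)) % suc k        ≡⟨ cong (_% suc k) (trans (+-suc J (suc (M + M))) (cong suc (+-suc J (M + M)))) ⟨
        (J + suc k) % suc k                    ≡⟨ [m+n]%n≡m%n J (suc k) ⟩
        J % suc k                              ≡⟨ m<n⇒m%n≡m J<1+k ⟩
        J                                      ∎)
        where open ≡-Reasoning
      by-size (no J≮M) (yes J≤2M) =
        let v , w , e , Z≡ = Z-falling (s≤s (subst (M + M ∸ J ≤_) (m+n∸n≡m M M) (∸-monoʳ-≤ (M + M) (≮⇒≥ J≮M)))) in
        v , w , e , trans (cong (_% suc k) (trans Z≡ (m∸[m∸n]≡n J≤2M))) (m<n⇒m%n≡m J<1+k)
      by-size (no _) (no J≰2M) = let v , w , e , Z≡k = Z-rising {0} z<s in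
        v , w , e , trans (cong (_% suc k) Z≡k) (trans (m<n⇒m%n≡m (n<1+n k)) (≤-antisym (≰⇒> J≰2M) (≤-pred J<1+k)))

  -- Without a vertex of height k the label k never occurs, so rotating it to the top
  -- value k + k ∸ 1 makes the labels increase by exactly one along non-backtracking walks.
  partB : (∀ q → height q ≢ k) → CircularlyPartite G (suc k)
  partB no-top = fromLabelling Z (λ e e′ z≢v → cong (_% suc k) (Z-exact e e′ z≢v)) Z-onto
    where
    X≢k : ∀ {v w} → E G v w → X v w ≢ k
    X≢k {v} {w} e X≡k = no-top w (trans (height-fold e) (trans (cong fold X≡k) (fold-small ≤-refl)))

    Z-exact : ∀ {v w z} → E G v w → E G w z → z ≢ v → Z w z ≡ suc (Z v w)
    Z-exact {v} {w} {z} e e′ z≢v = begin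
      (X w z + (M + M)) % (k + k)                    ≡⟨ cong (λ x → (x + (M + M)) % (k + k)) (X-periodic e e′ z≢v) ⟩
      (suc (X v w) % (k + k) + (M + M)) % (k + k)    ≡⟨ [m%d+n]%d≡[m+n]%d (suc (X v w)) (M + M) (k + k) ⟩
      suc (X v w + (M + M)) % (k + k)                ≡⟨ [1+m]%d≡1+m%d (X v w + (M + M)) (k + k) below-top ⟩
      suc (Z v w)                                    ∎
      where
      open ≡-Reasoning
      below-top : suc (Z v w) < k + k
      below-top = ≤∧≢⇒< (m%n<n (X v w + (M + M)) (k + k)) λ 1+Z≡k+k → X≢k e (begin
        X v w                          ≡⟨ m<n⇒m%n≡m (X<2k v w) ⟨
        X v w % (k + k)                ≡⟨ +-cancelˡ-% (M + M) (k + k) (begin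
          (M + M + X v w) % (k + k)      ≡⟨ cong (_% (k + k)) (+-comm (M + M) (X v w)) ⟩
          Z v w                          ≡⟨ suc-injective 1+Z≡k+k ⟩
          M + M + k                      ≡⟨ m<n⇒m%n≡m (n<1+n (M + M + k)) ⟨
          (M + M + k) % (k + k)          ∎) ⟩
        k % (k + k)                    ≡⟨ m<n⇒m%n≡m (m<m+n k z<s) ⟩
        k                              ∎)

  larger : ∃ λ K → k < K × CircularlyPartite G K
  larger = by-top (any? (λ q → height q ≟ k))
    where
    by-top : Dec (∃ λ q → height q ≡ k) → ∃ λ K → k < K × CircularlyPartite G K
    by-top (yes (q , hq)) = k + k , m<m+n k z<s , partA hq
    by-top (no no-top) = suc k , n<1+n k , partB λ q hq → no-top (q , hq)

odd⇒1+m+m : ∀ {k} → ¬ 2 ∣ k → ∃ λ M → k ≡ suc (M + M)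
odd⇒1+m+m {zero} odd = contradiction (2 ∣0) odd
odd⇒1+m+m {suc zero} _ = 0 , refl
odd⇒1+m+m {suc (suc k)} odd with odd⇒1+m+m {k} (odd ∘ ∣m∣n⇒∣m+n ∣-refl)
... | M , refl = suc M , cong (suc ∘ suc) (sym (+-suc M M))

module Consequences {n : ℕ} {G : Graph n} (conn : Connected G) where
  open Walks G
  open Colourings G
  open Labellings G

  even⇒2-colourable : ∀ {k} → CircularlyPartite G k → 2 ∣ k → Colourable G 2
  even⇒2-colourable P 2∣k =
    evenClosedWalks⇒2-colourable conn (proj₁ (Classes.anEdge P)) (Classes.2∣k⇒evenClosedWalks P 2∣k)

  odd⇒3-colourable : ∀ {k} → CircularlyPartite G k → 1 < k → ¬ 2 ∣ k → Colourable G 3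
  odd⇒3-colourable P 1<k odd with odd⇒1+m+m odd
  ... | zero , refl = contradiction 1<k (<-irrefl refl)
  ... | suc M , refl = ThreeColouring.3-colourable conn (s≤s z≤n) P

  private
    toℕ-flip : ∀ {a b : Fin 2} → a ≢ b → toℕ b % 2 ≡ suc (toℕ a) % 2
    toℕ-flip {Fin.zero} {Fin.zero} a≢b = contradiction refl a≢b
    toℕ-flip {Fin.zero} {Fin.suc Fin.zero} _ = refl
    toℕ-flip {Fin.suc Fin.zero} {Fin.zero} _ = refl
    toℕ-flip {Fin.suc Fin.zero} {Fin.suc Fin.zero} a≢b = contradiction refl a≢b

    parity-flip : ∀ {a b : Fin 2} → a ≢ b → parity (toℕ b) ≡ parity (toℕ a) ⁻¹
    parity-flip {Fin.zero} {Fin.zero} a≢b = contradiction refl a≢b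
    parity-flip {Fin.zero} {Fin.suc Fin.zero} _ = refl
    parity-flip {Fin.suc Fin.zero} {Fin.zero} _ = refl
    parity-flip {Fin.suc Fin.zero} {Fin.suc Fin.zero} a≢b = contradiction refl a≢b

    either : ∀ {a b : Fin 2} → a ≢ b → ∀ j → j < 2 → toℕ a % 2 ≡ j ⊎ toℕ b % 2 ≡ j
    either {Fin.zero} _ 0 _ = inj₁ refl
    either {Fin.zero} {Fin.zero} a≢b 1 _ = contradiction refl a≢b
    either {Fin.zero} {Fin.suc Fin.zero} _ 1 _ = inj₂ refl
    either {Fin.suc Fin.zero} _ 1 _ = inj₁ refl
    either {Fin.suc Fin.zero} {Fin.zero} _ 0 _ = inj₂ refl
    either {Fin.suc Fin.zero} {Fin.suc Fin.zero} a≢b 0 _ = contradiction refl a≢b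
    either _ (suc (suc _)) (s≤s (s≤s ()))

  2-colourable⇒2-partite : Colourable G 2 → ∀ {v₀ w₀} → E G v₀ w₀ → CircularlyPartite G 2
  2-colourable⇒2-partite (c , proper) {v₀} {w₀} e₀ = fromLabelling (λ v _ → toℕ (c v))
    (λ {v} {w} e _ _ → toℕ-flip (proper v w e))
    λ j j<2 → case (either (proper v₀ w₀ e₀) j j<2)
    where
    case : ∀ {j} → toℕ (c v₀) % 2 ≡ j ⊎ toℕ (c w₀) % 2 ≡ j →
      ∃₂ λ v w → E G v w × toℕ (c v) % 2 ≡ j
    case (inj₁ eq) = v₀ , w₀ , e₀ , eq
    case (inj₂ eq) = w₀ , v₀ , E-sym e₀ , eq

  bipartite⇒larger : ∀ {k} → Colourable G 2 → CircularlyPartite G k → ¬ 2 ∣ k →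
    ∃ λ K → k < K × CircularlyPartite G K
  bipartite⇒larger (c , proper) P odd with odd⇒1+m+m odd
  ... | zero , refl = 2 , ≤-refl , 2-colourable⇒2-partite (c , proper) (proj₂ (proj₂ (Classes.anEdge P)))
  ... | suc M , refl = Lift.larger conn (s≤s z≤n) P (parity ∘ toℕ ∘ c) (λ {v} {w} e → parity-flip (proper v w e))

  bipartite⇒even : ∀ {χo} → Colourable G 2 → IsOrientedEdgePeriodicColouringNumber G χo → 2 ∣ χo
  bipartite⇒even {χo} colourable (P , maximal) with 2 ∣? χo
  ... | yes 2∣χo = 2∣χo
  ... | no odd with bipartite⇒larger colourable P odd
  ... | K , χo<K , P′ = contradiction (maximal K P′) (<⇒≱ χo<K)

-- The argument works for every connected graph.
theorem3p5 : (n : ℕ) (G : Graph n) → Connected G → ¬ IsExtendedStar G →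
    (χ χo : ℕ) → IsChromaticNumber G χ → IsOrientedEdgePeriodicColouringNumber G χo →
    (((2 ∣ χo) ⇔ (χ ≡ 2)) × (1 < χo → ¬ (2 ∣ χo) → χ ≡ 3))
theorem3p5 _ G conn _ χ χo (colourable , minimal) periodic@(P , _) =
  mk⇔ (λ 2∣χo → ≤-antisym (minimal 2 (even⇒2-colourable P 2∣χo)) 2≤χ)
      (λ χ≡2 → bipartite⇒even (subst (Colourable G) χ≡2 colourable) periodic) ,
  λ 1<χo odd → ≤-antisym (minimal 3 (odd⇒3-colourable P 1<χo odd)) (3≤χ odd)
  where
  open Colourings G
  open Consequences conn
  2≤χ : 2 ≤ χ
  2≤χ = Colourable⇒2≤ (proj₂ (proj₂ (Classes.anEdge P))) colourable
  3≤χ : ¬ 2 ∣ χo → 3 ≤ χ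
  3≤χ odd = ≰⇒> λ χ≤2 → odd (bipartite⇒even (Colourable-mono χ≤2 colourable) periodic)
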